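{- Let $D$ be a digraph whose underlying graph admits two edge-magic labelings $f$ and $g$ with magic sums $\sigma_f\ne\sigma_g$. Let $\mathcal{S}_n^k$ be the set of all super edge-magic labeled (simple) digraphs with order and size equal to $n$ and magic sum $k$, each vertex named by its label, and let $h:E(D)\to\mathcal{S}_n^k$ be any function. For a labeling $\phi\in\{f,g\}$, let $\check\phi$ be the edge-magic labeling of $\mathrm{und}(D\otimes_h\mathcal{S}_n^k)$ defined (after renaming each vertex of $D$ by its $\phi$-label) by giving vertex $(i,j)$ the label $n(i-1)+j$ and the edge from arc $((i,j),(i',j'))$ the label $n(e-1)+k+n-(j+j')$, where $e=\phi(i,i')$. Then $$|\sigma_{\check f}-\sigma_{\check g}|\ge3.$$
   Context: All graphs are simple. For a graph with $p$ vertices and $q$ edges, an edge-magic labeling is a bijection $f:V\cup E\to\{1,\dots,p+q\}$ with $f(x)+f(xy)+f(y)$ constant (the magic sum, denoted $\sigma_f$) over all edges $xy$; super edge-magic additionally requires $f(V)=\{1,\dots,p\}$. Labelings of digraphs are labelings of their underlying graphs. Product: for a digraph $D$, a family $\Gamma$ of digraphs with common vertex set $V$ and $h:E(D)\to\Gamma$, $D\otimes_h\Gamma$ has vertex set $V(D)\times V$ and $((a,x),(b,y))$ is an arc iff $(a,b)\in E(D)$ and $(x,y)\in E(h(a,b))$. $\mathrm{und}$ is underlying graph. -}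

module Defs where

open import Data.Nat using (ℕ; suc; _+_; _*_; _∸_; _≤_)
open import Data.Fin using (Fin; toℕ)
open import Data.Product using (_×_; _,_; proj₁; proj₂; ∃)
open import Data.Sum using (_⊎_; inj₁; inj₂)
open import Data.Empty using (⊥)
open import Relation.Binary.PropositionalEquality using (_≡_; _≢_)
open import Function.Definitions using (Injective; Bijective)

-- Arcs are pairwise distinct, there are no loops, and no pair of
-- opposite arcs, so the underlying graph is simple and its edges are in
-- bijection with the arcs (edge t of und D = arc t of D).

record Digraph (p q : ℕ) : Set where
  field
    arc       : Fin q → Fin p × Fin p
    arc-inj   : Injective _≡_ _≡_ arc
    loopless  : ∀ t → proj₁ (arc t) ≢ proj₂ (arc t)
    oriented  : ∀ t u → proj₁ (arc t) ≡ proj₂ (arc u) →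
                proj₂ (arc t) ≡ proj₁ (arc u) → ⊥

  tail head : Fin q → Fin p
  tail t = proj₁ (arc t)
  head t = proj₂ (arc t)

open Digraph public

-- A labeling of (the underlying graph of) a digraph: a bijection
-- V ∪ E → {1, …, p + q}, encoded as a bijection onto Fin (p + q)
-- (label = 1 + toℕ of the image).

record Labeling {p q : ℕ} (D : Digraph p q) : Set where
  field
    fn  : Fin p ⊎ Fin q → Fin (p + q)
    bij : Bijective _≡_ _≡_ fn

  vlabel : Fin p → ℕ
  vlabel v = suc (toℕ (fn (inj₁ v)))

  elabel : Fin q → ℕ
  elabel t = suc (toℕ (fn (inj₂ t)))

open Labeling public

IsEdgeMagic : {p q : ℕ} (D : Digraph p q) → Labeling D → ℕ → Set
IsEdgeMagic D f σ =
  ∀ t → vlabel f (tail D t) + elabel f t + vlabel f (head D t) ≡ σ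

IsSuperEdgeMagic : {p q : ℕ} (D : Digraph p q) → Labeling D → ℕ → Set
IsSuperEdgeMagic {p} D f σ =
  IsEdgeMagic D f σ
  × (∀ v → vlabel f v ≤ p)
  × (∀ m → 1 ≤ m → m ≤ p → ∃ λ v → vlabel f v ≡ m)

-- An element of 𝒮ₙᵏ: a super edge-magic labeled simple digraph of order
-- and size n with magic sum k, each vertex named by its label
-- (vertex v : Fin n is named toℕ v + 1, and its label is exactly that).

record SEM (n k : ℕ) : Set where
  field
    G     : Digraph n n
    L     : Labeling G
    super : IsSuperEdgeMagic G L k
    named : ∀ v → vlabel L v ≡ suc (toℕ v)

open SEM public

ProductArc : {p q n k : ℕ} (D : Digraph p q) (h : Fin q → SEM n k) →
             Fin p × Fin n → Fin p × Fin n → Set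
ProductArc {n = n} D h (a , x) (b , y) =
  ∃ λ t → arc D t ≡ (a , b) × ∃ λ (u : Fin n) → arc (G (h t)) u ≡ (x , y)

checkV : {p q : ℕ} {D : Digraph p q} (n : ℕ) → Labeling D →
         Fin p × Fin n → ℕ
checkV n φ (a , x) = n * (vlabel φ a ∸ 1) + suc (toℕ x)

checkE : {p q : ℕ} {D : Digraph p q} (n k : ℕ) → Labeling D →
         Fin q → Fin n → Fin n → ℕ
checkE n k φ t x y =
  n * (elabel φ t ∸ 1) + (k + n ∸ (suc (toℕ x) + suc (toℕ y)))

CheckMagic : {p q n k : ℕ} (D : Digraph p q) (h : Fin q → SEM n k) →
             Labeling D → ℕ → Set
CheckMagic {p} {q} {n} {k} D h φ s =
  ∀ (a b : Fin p) (x y : Fin n) (t : Fin q) (u : Fin n) →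
  arc D t ≡ (a , b) → arc (G (h t)) u ≡ (x , y) →
  checkV n φ (a , x) + checkE n k φ t x y + checkV n φ (b , y) ≡ s

-- The vertex labels of φ̌ shift φ's labels into blocks of n consecutive values,
-- and the edge labels are chosen so that on each copy of a factor the
-- factor's magic sum k cancels; the magic sum of φ̌ is therefore
-- n(σ_φ − 3) + k + n, an affine function of σ_φ with slope n. Two different
-- magic sums σ_f ≠ σ_g thus give sums of φ̌ at distance at least n, and a
-- simple digraph with n ≥ 1 vertices and n arcs has n ≥ 3.
module Submission where

open import Defs
open import Data.Nat using (ℕ; zero; suc; _+_; _*_; _∸_; _≤_; _<_; s≤s; z≤n)
open import Data.Nat.Properties
open import Data.Nat.Tactic.RingSolver using (solve-∀)
open import Data.Fin using (Fin; toℕ; zero; suc)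
open import Data.Product using (_×_; _,_; proj₁; proj₂; ∃₂)
open import Data.Sum using (_⊎_; inj₁; inj₂)
open import Data.Empty using (⊥; ⊥-elim)
open import Function using (_∘_)
open import Relation.Binary using (tri<; tri≈; tri>)
open import Relation.Binary.PropositionalEquality
  using (_≡_; _≢_; refl; sym; trans; cong; cong₂; subst; module ≡-Reasoning)

suc+suc+suc≡3+ : ∀ a e b → suc a + suc e + suc b ≡ 3 + (a + e + b)
suc+suc+suc≡3+ = solve-∀

module _ {p q : ℕ} (D : Digraph p q) where

  arc-not-loop : ∀ {t i} → arc D t ≢ (i , i)
  arc-not-loop {t} e = loopless D t (trans (cong proj₁ e) (sym (cong proj₂ e)))

  arcs-not-opposite : ∀ {t u i j} → arc D t ≡ (i , j) → arc D u ≡ (j , i) → ⊥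
  arcs-not-opposite et eu =
    oriented D _ _ (trans (cong proj₁ et) (sym (cong proj₂ eu)))
                   (trans (cong proj₂ et) (sym (cong proj₁ eu)))

  magic-at : ∀ φ {σ t a b} → IsEdgeMagic D φ σ → arc D t ≡ (a , b) →
             vlabel φ a + elabel φ t + vlabel φ b ≡ σ
  magic-at φ {σ} {t} magic e =
    subst (λ ab → vlabel φ (proj₁ ab) + elabel φ t + vlabel φ (proj₂ ab) ≡ σ) e (magic t)

  magic-sum≥3 : ∀ φ {σ} → IsEdgeMagic D φ σ → Fin q → 3 ≤ σ
  magic-sum≥3 _ magic t =
    subst (3 ≤_) (trans (sym (suc+suc+suc≡3+ _ _ _)) (magic t)) (m≤m+n 3 _)

no-arcs-on-one-vertex : ∀ {q} (D : Digraph 1 q) → Fin q → ⊥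
no-arcs-on-one-vertex D t with arc D t in e
... | zero , zero = arc-not-loop D e

arcs-on-two-vertices-equal : ∀ {q} (D : Digraph 2 q) (t u : Fin q) → t ≡ u
arcs-on-two-vertices-equal D t u with arc D t in et | arc D u in eu
... | zero     , zero     | _                 = ⊥-elim (arc-not-loop D et)
... | suc zero , suc zero | _                 = ⊥-elim (arc-not-loop D et)
... | _                   | zero     , zero     = ⊥-elim (arc-not-loop D eu)
... | _                   | suc zero , suc zero = ⊥-elim (arc-not-loop D eu)
... | zero     , suc zero | zero     , suc zero = arc-inj D (trans et (sym eu))
... | suc zero , zero     | suc zero , zero     = arc-inj D (trans et (sym eu))
... | zero     , suc zero | suc zero , zero     = ⊥-elim (arcs-not-opposite D et eu)
... | suc zero , zero     | zero     , suc zero = ⊥-elim (arcs-not-opposite D et eu)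

order≥3 : ∀ {n} → Digraph n n → Fin n → 3 ≤ n
order≥3 {1} D t = ⊥-elim (no-arcs-on-one-vertex D t)
order≥3 {2} D _ with arcs-on-two-vertices-equal D zero (suc zero)
... | ()
order≥3 {suc (suc (suc _))} _ _ = s≤s (s≤s (s≤s z≤n))

block-magic-sum : ∀ n {k} a e b x u y → x + u + y ≡ k →
                  n * a + x + (n * e + (k + n ∸ (x + y))) + (n * b + y)
                    ≡ n * (suc a + suc e + suc b ∸ 3) + (k + n)
block-magic-sum n a e b x u y refl = begin
  n * a + x + (n * e + (x + u + y + n ∸ (x + y))) + (n * b + y)
    ≡⟨ cong (λ m → n * a + x + (n * e + m) + (n * b + y)) edge-offset ⟩
  n * a + x + (n * e + (u + n)) + (n * b + y)
    ≡⟨ regroup n a e b x u y ⟩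
  n * (a + e + b) + (x + u + y + n)
    ≡⟨ cong (λ m → n * m + (x + u + y + n)) (sym block-index) ⟩
  n * (suc a + suc e + suc b ∸ 3) + (x + u + y + n)
    ∎
  where
  open ≡-Reasoning
  regroup : ∀ n a e b x u y → n * a + x + (n * e + (u + n)) + (n * b + y)
                                ≡ n * (a + e + b) + (x + u + y + n)
  regroup = solve-∀
  interchange : ∀ x u y n → x + u + y + n ≡ (x + y) + (u + n)
  interchange = solve-∀
  edge-offset : x + u + y + n ∸ (x + y) ≡ u + n
  edge-offset = trans (cong (_∸ (x + y)) (interchange x u y n))
                      (m+n∸m≡n (x + y) (u + n))
  block-index : suc a + suc e + suc b ∸ 3 ≡ a + e + b
  block-index = trans (cong (_∸ 3) (suc+suc+suc≡3+ a e b)) (m+n∸m≡n 3 _)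

factor-magic-at : ∀ {n k} (S : SEM n k) {u x y} → arc (G S) u ≡ (x , y) →
                  suc (toℕ x) + elabel (L S) u + suc (toℕ y) ≡ k
factor-magic-at S {u} {x} {y} e =
  trans (cong₂ (λ v w → v + elabel (L S) u + w) (sym (named S x)) (sym (named S y)))
        (magic-at (G S) (L S) (proj₁ (super S)) e)

check-magic : ∀ {p q n k} (D : Digraph p q) (h : Fin q → SEM n k) φ {σ} →
              IsEdgeMagic D φ σ → CheckMagic D h φ (n * (σ ∸ 3) + (k + n))
check-magic {n = n} {k} D h φ magic a b x y t u ea eu =
  trans (block-magic-sum n _ _ _ _ _ _ (factor-magic-at (h t) eu))
        (cong (λ s → n * (s ∸ 3) + (k + n)) (magic-at D φ magic ea))

*-+-gap : ∀ {n F H} c → 3 ≤ n → F < H → n * F + c + 3 ≤ n * H + c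
*-+-gap {n} {F} {H} c 3≤n F<H = begin
  n * F + c + 3    ≤⟨ +-monoʳ-≤ (n * F + c) 3≤n ⟩
  n * F + c + n    ≡⟨ +-comm (n * F + c) n ⟩
  n + (n * F + c)  ≡⟨ sym (+-assoc n (n * F) c) ⟩
  n + n * F + c    ≡⟨ cong (_+ c) (sym (*-suc n F)) ⟩
  n * suc F + c    ≤⟨ +-monoˡ-≤ c (*-monoʳ-≤ n F<H) ⟩
  n * H + c        ∎
  where open ≤-Reasoning

*-+-separated : ∀ {n F H} c → 3 ≤ n → F ≢ H →
                n * F + c + 3 ≤ n * H + c ⊎ n * H + c + 3 ≤ n * F + c
*-+-separated {F = F} {H} c 3≤n F≢H with <-cmp F H
... | tri< F<H _ _ = inj₁ (*-+-gap c 3≤n F<H)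
... | tri≈ _ F≡H _ = ⊥-elim (F≢H F≡H)
... | tri> _ _ H<F = inj₂ (*-+-gap c 3≤n H<F)

corollary4p1 : ∀ {p q : ℕ} (D : Digraph p q) (f g : Labeling D) (σf σg : ℕ) →
                 IsEdgeMagic D f σf → IsEdgeMagic D g σg → σf ≢ σg →
                 ∀ (n k : ℕ) (h : Fin q → SEM n k) →
                 ∃₂ λ s₁ s₂ → CheckMagic D h f s₁ × CheckMagic D h g s₂
                   × (s₁ + 3 ≤ s₂ ⊎ s₂ + 3 ≤ s₁)
-- Without arcs in D or vertices in the factors the product has no edges.
corollary4p1 {q = zero} _ _ _ _ _ _ _ _ _ _ _ =
  0 , 3 , (λ _ _ _ _ ()) , (λ _ _ _ _ ()) , inj₁ ≤-refl
corollary4p1 {q = suc _} _ _ _ _ _ _ _ _ zero _ _ =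
  0 , 3 , (λ _ _ ()) , (λ _ _ ()) , inj₁ ≤-refl
corollary4p1 {q = suc _} D f g σf σg magic-f magic-g σf≢σg n@(suc _) k h =
  _ , _ , check-magic D h f magic-f , check-magic D h g magic-g ,
  *-+-separated (k + n) (order≥3 (G (h zero)) zero) σf∸3≢σg∸3
  where
  σf∸3≢σg∸3 : σf ∸ 3 ≢ σg ∸ 3
  σf∸3≢σg∸3 = σf≢σg ∘ ∸-cancelʳ-≡ (magic-sum≥3 D f magic-f zero)
                                    (magic-sum≥3 D g magic-g zero)
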